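{- For $n\ge0$ let $a_n$ be the number of permutations $\pi$ of $\{1,\dots,n\}$ with $\#132(\pi)=0$ and $\#123(\pi)=2$. Then $$\sum_{n\ge0}a_nz^n=\frac{z^4(1-z)}{(1-2z)^3}.$$
   Context: For a permutation $\pi=\pi_1\cdots\pi_n$, $\#123(\pi)$ is the number of triples $i_1<i_2<i_3$ with $\pi_{i_1}<\pi_{i_2}<\pi_{i_3}$, and $\#132(\pi)$ is the number of triples $i_1<i_2<i_3$ with $\pi_{i_1}<\pi_{i_3}<\pi_{i_2}$. -}

module Defs where

open import Data.Bool using (Bool; true; false; _∧_; if_then_else_)
open import Data.Nat as ℕ using (ℕ; zero; suc; _∸_)
open import Data.Integer as ℤ using (ℤ; +_)
open import Data.Fin as Fin using (Fin)
open import Data.List using (allFin)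
open import Data.Product using (_×_; _,_)
open import Data.List using (List; []; _∷_; map; concatMap; length; filterᵇ; sum; upTo; foldr)
open import Data.Bool.ListAction using (and)
open import Data.Vec.Functional using () renaming (_∷_ to _◂_)
open import Relation.Nullary using (does; ¬?)

-- Permutations of {1,…,n}, represented as bijections Fin n → Fin n
-- (π i = π_{i+1} - 1, zero-based).

allFuns : (n m : ℕ) → List (Fin n → Fin m)
allFuns zero    m = (λ ()) ∷ []
allFuns (suc n) m = concatMap (λ f → map (λ x → x ◂ f) (allFin m)) (allFuns n m)

countᵇ : {A : Set} → (A → Bool) → List A → ℕ
countᵇ p xs = length (filterᵇ p xs)

pairs : (n : ℕ) → List (Fin n × Fin n)
pairs n = concatMap (λ i → map (λ j → i , j) (allFin n)) (allFin n)

triples : (n : ℕ) → List (Fin n × Fin n × Fin n)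
triples n = concatMap (λ i → concatMap (λ j → map (λ k → i , j , k) (allFin n)) (allFin n)) (allFin n)

isPerm : {n : ℕ} → (Fin n → Fin n) → Bool
isPerm {n} f = and (map (λ { (i , j) → if does (i Fin.<? j) then does (¬? (f i Fin.≟ f j)) else true }) (pairs n))

perms : (n : ℕ) → List (Fin n → Fin n)
perms n = filterᵇ isPerm (allFuns n n)

occ123 : {n : ℕ} → (Fin n → Fin n) → ℕ
occ123 {n} π = countᵇ (λ { (i , j , k) →
  does (i Fin.<? j) ∧ does (j Fin.<? k) ∧ does (π i Fin.<? π j) ∧ does (π j Fin.<? π k) }) (triples n)

occ132 : {n : ℕ} → (Fin n → Fin n) → ℕ
occ132 {n} π = countᵇ (λ { (i , j , k) →
  does (i Fin.<? j) ∧ does (j Fin.<? k) ∧ does (π i Fin.<? π k) ∧ does (π k Fin.<? π j) }) (triples n)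

a : ℕ → ℕ
a n = countᵇ (λ π → does (occ132 π ℕ.≟ 0) ∧ does (occ123 π ℕ.≟ 2)) (perms n)

Series : Set
Series = ℕ → ℤ

sumℤ : List ℤ → ℤ
sumℤ = foldr ℤ._+_ (+ 0)

infixl 7 _⋆_
_⋆_ : Series → Series → Series
(f ⋆ g) n = sumℤ (map (λ k → f k ℤ.* g (n ∸ k)) (upTo (suc n)))

infixl 6 _⊕_ _⊖_
_⊕_ _⊖_ : Series → Series → Series
(f ⊕ g) n = f n ℤ.+ g n
(f ⊖ g) n = f n ℤ.- g n

const : ℤ → Series
const c zero    = c
const c (suc _) = + 0

z : Series
z 1 = + 1
z _ = + 0

_^ˢ_ : Series → ℕ → Series
f ^ˢ zero  = const (+ 1)
f ^ˢ suc k = f ⋆ (f ^ˢ k)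

ogf : (ℕ → ℕ) → Series
ogf a n = + (a n)

{-# OPTIONS --safe #-}
module Submission where

-- Write a permutation of size n+1 as x ◃ τ: first value x, followed by the
-- values of a permutation τ of size n shifted past x.  The new first value
-- forms a 132 with each inversion of τ among the values ≥ x, and a 123 with
-- each non-inversion there.  So x ◃ τ avoids 132 iff τ does and the values
-- ≥ x of τ increase; it then has C(n-x,2) more copies of 123 than τ, and its
-- own values ≥ y increase iff x ≤ y.  Hence the number of 132-avoiders with
-- c copies of 123 whose values ≥ y increase satisfies a recursion over x in
-- which, for c ≤ 2, only x ≥ n-2 contribute.  From size 2 on this closes up
-- into a linear recursion on five sequences whose transition matrix has
-- characteristic polynomial λ²(λ-2)³, so (1-2z)³ Σ aₙzⁿ has no terms beyond
-- z⁶; the first seven coefficients are evaluated.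

open import Defs
open import Data.Bool using (Bool; true; false; _∧_; not; if_then_else_; T)
open import Data.Bool.ListAction using (all)
open import Data.Bool.Properties using (∧-assoc; ∧-comm; ∧-zeroʳ; ∧-identityʳ)
open import Data.Empty using (⊥-elim)
open import Data.Fin as Fin using (Fin; zero; suc; toℕ; punchIn)
open import Data.Fin.Properties as Finₚ using (punchIn-injective; punchInᵢ≢i; toℕ<n)
import Data.Integer as ℤ
import Data.Integer.Properties as ℤₚ
import Data.Integer.Tactic.RingSolver as ℤ-Solver
open import Data.List using (List; []; _∷_; _++_; map; concatMap; filterᵇ; tabulate; allFin; upTo)
open import Data.List.Properties using (map-tabulate; map-applyUpTo; map-cong)
open import Data.Nat as ℕ
  using (ℕ; zero; suc; _+_; _*_; _∸_; _≤_; _<_; _≤ᵇ_; _<ᵇ_; _≡ᵇ_; z≤n; s≤s; s≤s⁻¹)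
open import Data.Nat.Combinatorics using (_C_; nC1≡n; nCk+nC[k+1]≡[n+1]C[k+1])
open import Data.Nat.GeneralisedArithmetic using (fold)
open import Data.Nat.Properties
open import Data.Nat.Tactic.RingSolver using (solve-∀)
open import Algebra.Properties.CommutativeSemigroup +-commutativeSemigroup using (interchange)
open import Data.Product using (_×_; _,_; proj₁)
open import Data.Vec.Functional using () renaming (_∷_ to _◂_)
open import Function using (_∘_)
open import Function.Definitions using (Injective)
open import Relation.Binary using (tri<; tri≈; tri>)
open import Relation.Binary.PropositionalEquality
open import Relation.Nullary using (does; yes; no)
open import Relation.Nullary.Decidable using (dec-true; dec-false)

-- Iverson brackets and finite sums

⟦_⟧ : Bool → ℕ
⟦ true ⟧  = 1
⟦ false ⟧ = 0

⟦∧⟧ : ∀ a b → ⟦ a ∧ b ⟧ ≡ ⟦ a ⟧ * ⟦ b ⟧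
⟦∧⟧ true  b = sym (+-identityʳ ⟦ b ⟧)
⟦∧⟧ false b = refl

⟦∧⟧-* : ∀ a b q → ⟦ a ∧ b ⟧ * q ≡ ⟦ a ⟧ * (⟦ b ⟧ * q)
⟦∧⟧-* a b q = trans (cong (_* q) (⟦∧⟧ a b)) (*-assoc ⟦ a ⟧ ⟦ b ⟧ q)

⟦∧⟧-swap : ∀ a b q → ⟦ a ∧ b ⟧ * q ≡ ⟦ b ⟧ * (⟦ a ⟧ * q)
⟦∧⟧-swap a b q = trans (cong (λ c → ⟦ c ⟧ * q) (∧-comm a b)) (⟦∧⟧-* b a q)

⟦⟧-mono : ∀ {a b} → (T a → T b) → ⟦ a ⟧ ≤ ⟦ b ⟧
⟦⟧-mono {false}          _   = z≤n
⟦⟧-mono {true}  {true}   _   = ≤-refl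
⟦⟧-mono {true}  {false}  a⇒b = ⊥-elim (a⇒b _)

⟦≤ᵇ⟧ : ∀ {m n} → m ≤ n → ⟦ m ≤ᵇ n ⟧ ≡ 1
⟦≤ᵇ⟧ {m} {n} m≤n = cong ⟦_⟧ (dec-true (m ℕ.≤? n) m≤n)

⟦≰ᵇ⟧ : ∀ {m n} → n < m → ⟦ m ≤ᵇ n ⟧ ≡ 0
⟦≰ᵇ⟧ {m} {n} n<m = cong ⟦_⟧ (dec-false (m ℕ.≤? n) (<⇒≱ n<m))

⟦+≡ᵇ⟧ : ∀ k o c → ⟦ k + o ≡ᵇ c ⟧ ≡ ⟦ k ≤ᵇ c ⟧ * ⟦ o ≡ᵇ c ∸ k ⟧
⟦+≡ᵇ⟧ k o c with k ℕ.≤? c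
... | no k≰c rewrite dec-false (k ℕ.≤? c) k≰c =
  cong ⟦_⟧ (dec-false (k + o ℕ.≟ c) (λ k+o≡c → k≰c (subst (k ≤_) k+o≡c (m≤m+n k o))))
... | yes k≤c rewrite dec-true (k ℕ.≤? c) k≤c with o ℕ.≟ c ∸ k
...   | yes o≡c∸k rewrite dec-true (o ℕ.≟ c ∸ k) o≡c∸k =
  cong ⟦_⟧ (dec-true (k + o ℕ.≟ c) (trans (cong (k +_) o≡c∸k) (m+[n∸m]≡n k≤c)))
...   | no  o≢c∸k rewrite dec-false (o ℕ.≟ c ∸ k) o≢c∸k =
  cong ⟦_⟧ (dec-false (k + o ℕ.≟ c) (λ k+o≡c →
    o≢c∸k (trans (sym (m+n∸m≡n k o)) (cong (_∸ k) k+o≡c))))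

≤ᵇ-suc : ∀ a b → (suc a ≤ᵇ suc b) ≡ (a ≤ᵇ b)
≤ᵇ-suc zero    b = refl
≤ᵇ-suc (suc a) b = refl

≤ᵇ-∧-≤ᵇ : ∀ t {a b} → a ≤ b → (t ≤ᵇ a) ∧ (t ≤ᵇ b) ≡ (t ≤ᵇ a)
≤ᵇ-∧-≤ᵇ t {a} {b} a≤b with t ℕ.≤? a
... | yes t≤a rewrite dec-true (t ℕ.≤? a) t≤a = dec-true (t ℕ.≤? b) (≤-trans t≤a a≤b)
... | no  t≰a rewrite dec-false (t ℕ.≤? a) t≰a = refl

∑ : {A : Set} → List A → (A → ℕ) → ℕ
∑ []       f = 0
∑ (x ∷ xs) f = f x + ∑ xs f

syntax ∑ xs (λ x → e) = ∑[ x ∈ xs ] e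

module _ {A : Set} where

  ∑-cong : ∀ xs {f g : A → ℕ} → (∀ x → f x ≡ g x) → ∑ xs f ≡ ∑ xs g
  ∑-cong []       f≗g = refl
  ∑-cong (x ∷ xs) f≗g = cong₂ _+_ (f≗g x) (∑-cong xs f≗g)

  ∑-zero : ∀ xs {f : A → ℕ} → (∀ x → f x ≡ 0) → ∑ xs f ≡ 0
  ∑-zero []       f≗0 = refl
  ∑-zero (x ∷ xs) f≗0 = cong₂ _+_ (f≗0 x) (∑-zero xs f≗0)

  ∑-mono-≤ : ∀ xs {f g : A → ℕ} → (∀ x → f x ≤ g x) → ∑ xs f ≤ ∑ xs g
  ∑-mono-≤ []       f≤g = z≤n
  ∑-mono-≤ (x ∷ xs) f≤g = +-mono-≤ (f≤g x) (∑-mono-≤ xs f≤g)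

  ∑-++ : ∀ xs ys (f : A → ℕ) → ∑ (xs ++ ys) f ≡ ∑ xs f + ∑ ys f
  ∑-++ []       ys f = refl
  ∑-++ (x ∷ xs) ys f = trans (cong (f x +_) (∑-++ xs ys f)) (sym (+-assoc (f x) _ _))

  ∑-distrib-+ : ∀ xs (f g : A → ℕ) → ∑[ x ∈ xs ] (f x + g x) ≡ ∑ xs f + ∑ xs g
  ∑-distrib-+ []       f g = refl
  ∑-distrib-+ (x ∷ xs) f g =
    trans (cong (f x + g x +_) (∑-distrib-+ xs f g)) (interchange (f x) (g x) _ _)

  ∑-*ˡ : ∀ xs c (f : A → ℕ) → ∑[ x ∈ xs ] (c * f x) ≡ c * ∑ xs f
  ∑-*ˡ []       c f = sym (*-zeroʳ c)
  ∑-*ˡ (x ∷ xs) c f = trans (cong (c * f x +_) (∑-*ˡ xs c f)) (sym (*-distribˡ-+ c (f x) _))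

  ∑-filterᵇ : ∀ (p : A → Bool) xs f → ∑ (filterᵇ p xs) f ≡ ∑[ x ∈ xs ] (⟦ p x ⟧ * f x)
  ∑-filterᵇ p []       f = refl
  ∑-filterᵇ p (x ∷ xs) f with p x
  ... | true  = cong₂ _+_ (sym (+-identityʳ (f x))) (∑-filterᵇ p xs f)
  ... | false = ∑-filterᵇ p xs f

  countᵇ≡∑ : ∀ (p : A → Bool) xs → countᵇ p xs ≡ ∑[ x ∈ xs ] ⟦ p x ⟧
  countᵇ≡∑ p []       = refl
  countᵇ≡∑ p (x ∷ xs) with p x
  ... | true  = cong suc (countᵇ≡∑ p xs)
  ... | false = countᵇ≡∑ p xs

module _ {A B : Set} where

  ∑-map : ∀ (g : A → B) xs f → ∑ (map g xs) f ≡ ∑ xs (f ∘ g)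
  ∑-map g []       f = refl
  ∑-map g (x ∷ xs) f = cong (f (g x) +_) (∑-map g xs f)

  ∑-concatMap : ∀ (g : A → List B) xs f → ∑ (concatMap g xs) f ≡ ∑[ x ∈ xs ] ∑ (g x) f
  ∑-concatMap g []       f = refl
  ∑-concatMap g (x ∷ xs) f = trans (∑-++ (g x) _ f) (cong (∑ (g x) f +_) (∑-concatMap g xs f))

  ∑-comm : ∀ xs ys (f : A → B → ℕ) →
           ∑[ x ∈ xs ] ∑[ y ∈ ys ] f x y ≡ ∑[ y ∈ ys ] ∑[ x ∈ xs ] f x y
  ∑-comm []       ys f = sym (∑-zero ys (λ _ → refl))
  ∑-comm (x ∷ xs) ys f =
    trans (cong (∑ ys (f x) +_) (∑-comm xs ys f)) (sym (∑-distrib-+ ys (f x) _))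

∑-allFin-suc : ∀ n (f : Fin (suc n) → ℕ) →
               ∑ (allFin (suc n)) f ≡ f zero + ∑[ i ∈ allFin n ] f (suc i)
∑-allFin-suc n f = cong (f zero +_) (begin
  ∑ (tabulate suc) f           ≡⟨ cong (λ is → ∑ is f) (map-tabulate (λ i → i) suc) ⟨
  ∑ (map suc (allFin n)) f     ≡⟨ ∑-map suc (allFin n) f ⟩
  ∑[ i ∈ allFin n ] f (suc i)  ∎)
  where open ≡-Reasoning

∑-allFin-suc-tail : ∀ n (f : Fin (suc n) → ℕ) → f zero ≡ 0 →
                    ∑ (allFin (suc n)) f ≡ ∑[ i ∈ allFin n ] f (suc i)
∑-allFin-suc-tail n f f0≡0 =
  trans (∑-allFin-suc n f) (cong (_+ ∑[ i ∈ allFin n ] f (suc i)) f0≡0)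

∑-allFin-last3 : ∀ m (g : ℕ → ℕ) → (∀ k → k < m → g k ≡ 0) →
                 ∑[ x ∈ allFin (3 + m) ] g (toℕ x) ≡ g m + g (1 + m) + g (2 + m)
∑-allFin-last3 zero    g _   =
  trans (cong (λ r → g 0 + (g 1 + r)) (+-identityʳ (g 2))) (sym (+-assoc (g 0) (g 1) (g 2)))
∑-allFin-last3 (suc m) g g≡0 = trans (∑-allFin-suc-tail (3 + m) (g ∘ toℕ) (g≡0 0 (s≤s z≤n)))
  (∑-allFin-last3 m (g ∘ suc) (λ k k<m → g≡0 (suc k) (s≤s k<m)))

module _ {A : Set} where

  all-++ : ∀ (p : A → Bool) xs ys → all p (xs ++ ys) ≡ all p xs ∧ all p ys
  all-++ p []       ys = refl
  all-++ p (x ∷ xs) ys = trans (cong (p x ∧_) (all-++ p xs ys)) (sym (∧-assoc (p x) _ _))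

  all-cong : ∀ xs {p q : A → Bool} → (∀ x → p x ≡ q x) → all p xs ≡ all q xs
  all-cong []       p≗q = refl
  all-cong (x ∷ xs) p≗q = cong₂ _∧_ (p≗q x) (all-cong xs p≗q)

module _ {A B : Set} where

  all-map : ∀ (p : B → Bool) (g : A → B) xs → all p (map g xs) ≡ all (p ∘ g) xs
  all-map p g []       = refl
  all-map p g (x ∷ xs) = cong (p (g x) ∧_) (all-map p g xs)

  all-concatMap : ∀ (p : B → Bool) (g : A → List B) xs →
                  all p (concatMap g xs) ≡ all (λ x → all p (g x)) xs
  all-concatMap p g []       = refl
  all-concatMap p g (x ∷ xs) = trans (all-++ p (g x) _) (cong (all p (g x) ∧_) (all-concatMap p g xs))

all-allFin-suc : ∀ n (p : Fin (suc n) → Bool) →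
                 all p (allFin (suc n)) ≡ p zero ∧ all (p ∘ suc) (allFin n)
all-allFin-suc n p = cong (p zero ∧_) (begin
  all p (tabulate suc)        ≡⟨ cong (all p) (map-tabulate (λ i → i) suc) ⟨
  all p (map suc (allFin n))  ≡⟨ all-map p suc (allFin n) ⟩
  all (p ∘ suc) (allFin n)    ∎)
  where open ≡-Reasoning

suc-C2 : ∀ m → suc m C 2 ≡ m + m C 2
suc-C2 m = trans (sym (nCk+nC[k+1]≡[n+1]C[k+1] m 1)) (cong (_+ m C 2) (nC1≡n m))

3≤C2 : ∀ {k} → 3 ≤ k → 3 ≤ k C 2
3≤C2 {suc (suc (suc j))} (s≤s (s≤s (s≤s z≤n))) = begin
  3                                 ≤⟨ +-mono-≤ (m≤m+n 2 j) (s≤s z≤n) ⟩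
  (2 + j) + ((1 + j) + (1 + j) C 2) ≡⟨ cong ((2 + j) +_) (suc-C2 (1 + j)) ⟨
  (2 + j) + (2 + j) C 2             ≡⟨ suc-C2 (2 + j) ⟨
  (3 + j) C 2                       ∎
  where open ≤-Reasoning

-- Permutations by their first value

_<ᶠ_ : ∀ {n} → Fin n → Fin n → Bool
i <ᶠ j = does (i Fin.<? j)

_≢ᵇ_ : ∀ {n} → Fin n → Fin n → Bool
i ≢ᵇ j = not (does (i Fin.≟ j))

avoids : ∀ {n m} → Fin m → (Fin n → Fin m) → Bool
avoids {zero}  y f = true
avoids {suc n} y f = (y ≢ᵇ f zero) ∧ avoids y (f ∘ suc)

injectiveᵇ : ∀ {n m} → (Fin n → Fin m) → Bool
injectiveᵇ {zero}  f = true
injectiveᵇ {suc n} f = avoids (f zero) (f ∘ suc) ∧ injectiveᵇ (f ∘ suc)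

pairwiseDistinctᵇ : ∀ {n m} → (Fin n → Fin m) → Bool
pairwiseDistinctᵇ {n} f =
  all (λ i → all (λ j → if i <ᶠ j then f i ≢ᵇ f j else true) (allFin n)) (allFin n)

avoids≡all : ∀ {n m} (y : Fin m) (f : Fin n → Fin m) →
             avoids y f ≡ all (λ j → y ≢ᵇ f j) (allFin n)
avoids≡all {zero}  y f = refl
avoids≡all {suc n} y f =
  trans (cong ((y ≢ᵇ f zero) ∧_) (avoids≡all y (f ∘ suc))) (sym (all-allFin-suc n _))

pairwiseDistinctᵇ≡injectiveᵇ : ∀ {n m} (f : Fin n → Fin m) → pairwiseDistinctᵇ f ≡ injectiveᵇ f
pairwiseDistinctᵇ≡injectiveᵇ {zero}  f = refl
pairwiseDistinctᵇ≡injectiveᵇ {suc n} f = begin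
  pairwiseDistinctᵇ f
    ≡⟨ all-allFin-suc n (λ i → all (row i) (allFin (suc n))) ⟩
  all (row zero) (allFin (suc n)) ∧ all (λ i → all (row (suc i)) (allFin (suc n))) (allFin n)
    ≡⟨ cong₂ _∧_ (trans (all-allFin-suc n (row zero)) (sym (avoids≡all (f zero) (f ∘ suc))))
                 (all-cong (allFin n) (λ i → all-allFin-suc n (row (suc i)))) ⟩
  avoids (f zero) (f ∘ suc) ∧ pairwiseDistinctᵇ (f ∘ suc)
    ≡⟨ cong (avoids (f zero) (f ∘ suc) ∧_) (pairwiseDistinctᵇ≡injectiveᵇ (f ∘ suc)) ⟩
  injectiveᵇ f ∎
  where
  open ≡-Reasoning
  row : Fin (suc n) → Fin (suc n) → Bool
  row i j = if i <ᶠ j then f i ≢ᵇ f j else true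

isPerm≡injectiveᵇ : ∀ {n} (f : Fin n → Fin n) → isPerm f ≡ injectiveᵇ f
isPerm≡injectiveᵇ {n} f = begin
  isPerm f
    ≡⟨ all-concatMap _ (λ i → map (i ,_) (allFin n)) (allFin n) ⟩
  all (λ i → all _ (map (i ,_) (allFin n))) (allFin n)
    ≡⟨ all-cong (allFin n) (λ i → all-map _ (i ,_) (allFin n)) ⟩
  pairwiseDistinctᵇ f
    ≡⟨ pairwiseDistinctᵇ≡injectiveᵇ f ⟩
  injectiveᵇ f ∎
  where open ≡-Reasoning

∑-punchIn : ∀ m (y : Fin (suc m)) (h : Fin (suc m) → ℕ) →
            ∑[ v ∈ allFin (suc m) ] (⟦ y ≢ᵇ v ⟧ * h v) ≡ ∑[ v ∈ allFin m ] h (punchIn y v)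
∑-punchIn m zero h =
  trans (∑-allFin-suc m (λ v → ⟦ zero ≢ᵇ v ⟧ * h v))
        (∑-cong (allFin m) (λ v → +-identityʳ (h (suc v))))
∑-punchIn (suc m) (suc y) h = begin
  ∑[ v ∈ allFin (suc (suc m)) ] (⟦ suc y ≢ᵇ v ⟧ * h v)
    ≡⟨ ∑-allFin-suc (suc m) (λ v → ⟦ suc y ≢ᵇ v ⟧ * h v) ⟩
  h zero + 0 + ∑[ v ∈ allFin (suc m) ] (⟦ y ≢ᵇ v ⟧ * h (suc v))
    ≡⟨ cong₂ _+_ (+-identityʳ (h zero)) (∑-punchIn m y (h ∘ suc)) ⟩
  h zero + ∑[ v ∈ allFin m ] h (suc (punchIn y v))
    ≡⟨ ∑-allFin-suc m (λ v → h (punchIn (suc y) v)) ⟨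
  ∑[ v ∈ allFin (suc m) ] h (punchIn (suc y) v) ∎
  where open ≡-Reasoning

-- Absurd lambdas are not definitionally equal to each other, so the one
-- enumerated by `allFuns 0 m` is reused instead of writing a new one.
emptyFun : ∀ {m} → Fin 0 → Fin m
emptyFun {m} with allFuns 0 m
... | f ∷ _ = f
... | []    = λ ()

-- `lift y τ` is `punchIn y ∘ τ` pointwise (`lift-apply`), but it is built by
-- the same recursion as `allFuns`.
lift : ∀ {n m} → Fin (suc m) → (Fin n → Fin m) → Fin n → Fin (suc m)
lift {zero}  y τ = emptyFun
lift {suc n} y τ = punchIn y (τ zero) ◂ lift y (τ ∘ suc)

lift-apply : ∀ {n m} (y : Fin (suc m)) (τ : Fin n → Fin m) j → lift y τ j ≡ punchIn y (τ j)
lift-apply y τ zero    = refl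
lift-apply y τ (suc j) = lift-apply y (τ ∘ suc) j

∑-avoids : ∀ n {m} (y : Fin (suc m)) (Q : (Fin n → Fin (suc m)) → ℕ) →
           ∑[ f ∈ allFuns n (suc m) ] (⟦ avoids y f ⟧ * Q f)
           ≡ ∑[ τ ∈ allFuns n m ] Q (lift y τ)
∑-avoids zero    y Q = cong (_+ 0) (+-identityʳ _)
∑-avoids (suc n) {m} y Q = begin
  ∑[ f ∈ allFuns (suc n) (suc m) ] (⟦ avoids y f ⟧ * Q f)
    ≡⟨ ∑-concatMap _ (allFuns n (suc m)) _ ⟩
  ∑[ f ∈ allFuns n (suc m) ] ∑[ g ∈ map (_◂ f) (allFin (suc m)) ] (⟦ avoids y g ⟧ * Q g)
    ≡⟨ ∑-cong (allFuns n (suc m)) (λ f → ∑-map (_◂ f) (allFin (suc m)) _) ⟩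
  ∑[ f ∈ allFuns n (suc m) ] ∑[ v ∈ allFin (suc m) ] (⟦ (y ≢ᵇ v) ∧ avoids y f ⟧ * Q (v ◂ f))
    ≡⟨ ∑-cong (allFuns n (suc m)) (λ f → trans
         (∑-cong (allFin (suc m)) (λ v → ⟦∧⟧-swap (y ≢ᵇ v) (avoids y f) (Q (v ◂ f))))
         (∑-*ˡ (allFin (suc m)) ⟦ avoids y f ⟧ _)) ⟩
  ∑[ f ∈ allFuns n (suc m) ] (⟦ avoids y f ⟧ * ∑[ v ∈ allFin (suc m) ] (⟦ y ≢ᵇ v ⟧ * Q (v ◂ f)))
    ≡⟨ ∑-cong (allFuns n (suc m)) (λ f →
         cong (⟦ avoids y f ⟧ *_) (∑-punchIn m y (λ v → Q (v ◂ f)))) ⟩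
  ∑[ f ∈ allFuns n (suc m) ] (⟦ avoids y f ⟧ * ∑[ v ∈ allFin m ] Q (punchIn y v ◂ f))
    ≡⟨ ∑-avoids n y (λ f → ∑[ v ∈ allFin m ] Q (punchIn y v ◂ f)) ⟩
  ∑[ τ ∈ allFuns n m ] ∑[ v ∈ allFin m ] Q (punchIn y v ◂ lift y τ)
    ≡⟨ ∑-cong (allFuns n m) (λ τ → ∑-map (_◂ τ) (allFin m) _) ⟨
  ∑[ τ ∈ allFuns n m ] ∑[ τ′ ∈ map (_◂ τ) (allFin m) ] Q (lift y τ′)
    ≡⟨ ∑-concatMap _ (allFuns n m) _ ⟨
  ∑[ τ ∈ allFuns (suc n) m ] Q (lift y τ) ∎
  where open ≡-Reasoning

≢ᵇ-punchIn : ∀ {m} (y : Fin (suc m)) (a b : Fin m) → (punchIn y a ≢ᵇ punchIn y b) ≡ (a ≢ᵇ b)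
≢ᵇ-punchIn zero    a       b       = refl
≢ᵇ-punchIn (suc y) zero    zero    = refl
≢ᵇ-punchIn (suc y) zero    (suc b) = refl
≢ᵇ-punchIn (suc y) (suc a) zero    = refl
≢ᵇ-punchIn (suc y) (suc a) (suc b) = ≢ᵇ-punchIn y a b

avoids-lift : ∀ {n m} (y : Fin (suc m)) (a : Fin m) (τ : Fin n → Fin m) →
              avoids (punchIn y a) (lift y τ) ≡ avoids a τ
avoids-lift {zero}  y a τ = refl
avoids-lift {suc n} y a τ = cong₂ _∧_ (≢ᵇ-punchIn y a (τ zero)) (avoids-lift y a (τ ∘ suc))

injectiveᵇ-lift : ∀ {n m} (y : Fin (suc m)) (τ : Fin n → Fin m) →
                  injectiveᵇ (lift y τ) ≡ injectiveᵇ τ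
injectiveᵇ-lift {zero}  y τ = refl
injectiveᵇ-lift {suc n} y τ =
  cong₂ _∧_ (avoids-lift y (τ zero) (τ ∘ suc)) (injectiveᵇ-lift y (τ ∘ suc))

infixr 5 _◃_
_◃_ : ∀ {n} → Fin (suc n) → (Fin n → Fin n) → Fin (suc n) → Fin (suc n)
x ◃ τ = x ◂ lift x τ

∑-perms-suc : ∀ n (P : (Fin (suc n) → Fin (suc n)) → ℕ) →
              ∑ (perms (suc n)) P ≡ ∑[ x ∈ allFin (suc n) ] ∑[ τ ∈ perms n ] P (x ◃ τ)
∑-perms-suc n P = begin
  ∑ (perms (suc n)) P
    ≡⟨ ∑-filterᵇ isPerm (allFuns (suc n) (suc n)) P ⟩
  ∑[ π ∈ allFuns (suc n) (suc n) ] (⟦ isPerm π ⟧ * P π)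
    ≡⟨ ∑-cong (allFuns (suc n) (suc n)) (λ π →
         cong (λ b → ⟦ b ⟧ * P π) (isPerm≡injectiveᵇ π)) ⟩
  ∑[ π ∈ allFuns (suc n) (suc n) ] (⟦ injectiveᵇ π ⟧ * P π)
    ≡⟨ ∑-concatMap _ (allFuns n (suc n)) _ ⟩
  ∑[ f ∈ allFuns n (suc n) ] ∑[ π ∈ map (_◂ f) (allFin (suc n)) ] (⟦ injectiveᵇ π ⟧ * P π)
    ≡⟨ ∑-cong (allFuns n (suc n)) (λ f → trans (∑-map (_◂ f) (allFin (suc n)) _)
         (∑-cong (allFin (suc n)) (λ x → ⟦∧⟧-* (avoids x f) (injectiveᵇ f) (P (x ◂ f))))) ⟩
  ∑[ f ∈ allFuns n (suc n) ] ∑[ x ∈ allFin (suc n) ] (⟦ avoids x f ⟧ * Q x f)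
    ≡⟨ ∑-comm (allFuns n (suc n)) (allFin (suc n)) _ ⟩
  ∑[ x ∈ allFin (suc n) ] ∑[ f ∈ allFuns n (suc n) ] (⟦ avoids x f ⟧ * Q x f)
    ≡⟨ ∑-cong (allFin (suc n)) (λ x → ∑-avoids n x (Q x)) ⟩
  ∑[ x ∈ allFin (suc n) ] ∑[ τ ∈ allFuns n n ] (⟦ injectiveᵇ (lift x τ) ⟧ * P (x ◃ τ))
    ≡⟨ ∑-cong (allFin (suc n)) (λ x → ∑-cong (allFuns n n) (λ τ →
         cong (λ b → ⟦ b ⟧ * P (x ◃ τ)) (trans (injectiveᵇ-lift x τ) (sym (isPerm≡injectiveᵇ τ))))) ⟩
  ∑[ x ∈ allFin (suc n) ] ∑[ τ ∈ allFuns n n ] (⟦ isPerm τ ⟧ * P (x ◃ τ))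
    ≡⟨ ∑-cong (allFin (suc n)) (λ x → ∑-filterᵇ isPerm (allFuns n n) _) ⟨
  ∑[ x ∈ allFin (suc n) ] ∑[ τ ∈ perms n ] P (x ◃ τ) ∎
  where
  open ≡-Reasoning
  Q : Fin (suc n) → (Fin n → Fin (suc n)) → ℕ
  Q x f = ⟦ injectiveᵇ f ⟧ * P (x ◂ f)

-- Patterns created by a new first value

#pairs : ∀ {n} → (Fin n → Fin n → Bool) → ℕ
#pairs {n} P = ∑[ j ∈ allFin n ] ∑[ k ∈ allFin n ] ⟦ (j <ᶠ k) ∧ P j k ⟧

#triples : ∀ {n} → (Fin n → Fin n → Fin n → Bool) → ℕ
#triples {n} P =
  ∑[ i ∈ allFin n ] ∑[ j ∈ allFin n ] ∑[ k ∈ allFin n ] ⟦ (i <ᶠ j) ∧ (j <ᶠ k) ∧ P i j k ⟧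

module _ {n : ℕ} where

  #pairs-cong : {P Q : Fin n → Fin n → Bool} → (∀ j k → P j k ≡ Q j k) → #pairs P ≡ #pairs Q
  #pairs-cong P≗Q = ∑-cong (allFin n) (λ j → ∑-cong (allFin n) (λ k →
    cong (λ b → ⟦ (j <ᶠ k) ∧ b ⟧) (P≗Q j k)))

  #triples-cong : {P Q : Fin n → Fin n → Fin n → Bool} →
                  (∀ i j k → P i j k ≡ Q i j k) → #triples P ≡ #triples Q
  #triples-cong P≗Q = ∑-cong (allFin n) (λ i → ∑-cong (allFin n) (λ j → ∑-cong (allFin n) (λ k →
    cong (λ b → ⟦ (i <ᶠ j) ∧ (j <ᶠ k) ∧ b ⟧) (P≗Q i j k))))

#pairs-suc : ∀ {n} (P : Fin (suc n) → Fin (suc n) → Bool) →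
             #pairs P ≡ ∑[ k ∈ allFin n ] ⟦ P zero (suc k) ⟧ + #pairs (λ j k → P (suc j) (suc k))
#pairs-suc {n} P = trans (∑-allFin-suc n (λ j → ∑[ k ∈ allFin (suc n) ] ⟦ (j <ᶠ k) ∧ P j k ⟧))
  (cong₂ _+_ (∑-allFin-suc-tail n (λ k → ⟦ (zero <ᶠ k) ∧ P zero k ⟧) refl)
             (∑-cong (allFin n) (λ j →
               ∑-allFin-suc-tail n (λ k → ⟦ (suc j <ᶠ k) ∧ P (suc j) k ⟧) refl)))

#triples-suc : ∀ {n} (P : Fin (suc n) → Fin (suc n) → Fin (suc n) → Bool) →
               #triples P ≡ #pairs (λ j k → P zero (suc j) (suc k))
                            + #triples (λ i j k → P (suc i) (suc j) (suc k))
#triples-suc {n} P =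
  trans (∑-allFin-suc n (λ i → ∑[ j ∈ allFin (suc n) ] ∑[ k ∈ allFin (suc n) ] term i j k))
        (cong₂ _+_ (dropFirst zero (λ j → refl))
                   (∑-cong (allFin n) (λ i → dropFirst (suc i) (λ j → cong ⟦_⟧ (∧-zeroʳ (i <ᶠ j))))))
  where
  term : Fin (suc n) → Fin (suc n) → Fin (suc n) → ℕ
  term i j k = ⟦ (i <ᶠ j) ∧ (j <ᶠ k) ∧ P i j k ⟧
  dropFirst : ∀ i → (∀ j → term i (suc j) zero ≡ 0) →
              ∑[ j ∈ allFin (suc n) ] ∑[ k ∈ allFin (suc n) ] term i j k
              ≡ ∑[ j ∈ allFin n ] ∑[ k ∈ allFin n ] term i (suc j) (suc k)
  dropFirst i term0≡0 =
    trans (∑-allFin-suc-tail n (λ j → ∑[ k ∈ allFin (suc n) ] term i j k)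
                             (∑-zero (allFin (suc n)) (λ _ → refl)))
          (∑-cong (allFin n) (λ j → ∑-allFin-suc-tail n (term i (suc j)) (term0≡0 j)))

countᵇ-triples : ∀ {n} (p : Fin n × Fin n × Fin n → Bool) →
                 countᵇ p (triples n)
                 ≡ ∑[ i ∈ allFin n ] ∑[ j ∈ allFin n ] ∑[ k ∈ allFin n ] ⟦ p (i , j , k) ⟧
countᵇ-triples {n} p = trans (countᵇ≡∑ p (triples n)) (trans (∑-concatMap _ (allFin n) _)
  (∑-cong (allFin n) (λ i → trans (∑-concatMap _ (allFin n) _)
    (∑-cong (allFin n) (λ j → ∑-map _ (allFin n) _)))))

forms123 forms132 : ∀ {n} → (Fin n → Fin n) → Fin n → Fin n → Fin n → Bool
forms123 π i j k = (π i <ᶠ π j) ∧ (π j <ᶠ π k)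
forms132 π i j k = (π i <ᶠ π k) ∧ (π k <ᶠ π j)

occ123≡#triples : ∀ {n} (π : Fin n → Fin n) → occ123 π ≡ #triples (forms123 π)
occ123≡#triples π =
  countᵇ-triples (λ { (i , j , k) → (i <ᶠ j) ∧ (j <ᶠ k) ∧ forms123 π i j k })

occ132≡#triples : ∀ {n} (π : Fin n → Fin n) → occ132 π ≡ #triples (forms132 π)
occ132≡#triples π =
  countᵇ-triples (λ { (i , j , k) → (i <ᶠ j) ∧ (j <ᶠ k) ∧ forms132 π i j k })

#pairs-mono : ∀ {n} {P Q : Fin n → Fin n → Bool} →
              (∀ j k → T (P j k) → T (Q j k)) → #pairs P ≤ #pairs Q
#pairs-mono {n} P⇒Q =
  ∑-mono-≤ (allFin n) (λ j → ∑-mono-≤ (allFin n) (λ k → ⟦⟧-mono (restrict j k)))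
  where
  restrict : ∀ j k → T ((j <ᶠ k) ∧ _) → T ((j <ᶠ k) ∧ _)
  restrict j k with j <ᶠ k
  ... | true  = P⇒Q j k
  ... | false = λ ()

#pairs-both : ∀ {n} (P : Fin n → Bool) →
              #pairs (λ j k → P j ∧ P k) ≡ (∑[ j ∈ allFin n ] ⟦ P j ⟧) C 2
#pairs-both {zero}  P = refl
#pairs-both {suc n} P = begin
  #pairs (λ j k → P j ∧ P k)
    ≡⟨ #pairs-suc (λ j k → P j ∧ P k) ⟩
  ∑[ k ∈ allFin n ] ⟦ P zero ∧ P (suc k) ⟧ + #pairs (λ j k → P (suc j) ∧ P (suc k))
    ≡⟨ cong₂ _+_ (trans (∑-cong (allFin n) (λ k → ⟦∧⟧ (P zero) (P (suc k))))
                        (∑-*ˡ (allFin n) ⟦ P zero ⟧ _))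
                 (#pairs-both (P ∘ suc)) ⟩
  ⟦ P zero ⟧ * S + S C 2
    ≡⟨ add-first (P zero) ⟩
  (⟦ P zero ⟧ + S) C 2
    ≡⟨ cong (_C 2) (∑-allFin-suc n (λ j → ⟦ P j ⟧)) ⟨
  (∑[ j ∈ allFin (suc n) ] ⟦ P j ⟧) C 2 ∎
  where
  open ≡-Reasoning
  S = ∑[ j ∈ allFin n ] ⟦ P (suc j) ⟧
  add-first : ∀ b → ⟦ b ⟧ * S + S C 2 ≡ (⟦ b ⟧ + S) C 2
  add-first true  = trans (cong (_+ S C 2) (+-identityʳ S)) (sym (suc-C2 S))
  add-first false = refl

<ᶠ-punchIn : ∀ {m} (y : Fin (suc m)) (a b : Fin m) → (punchIn y a <ᶠ punchIn y b) ≡ (a <ᶠ b)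
<ᶠ-punchIn zero    a       b       = refl
<ᶠ-punchIn (suc y) zero    zero    = refl
<ᶠ-punchIn (suc y) zero    (suc b) = refl
<ᶠ-punchIn (suc y) (suc a) zero    = refl
<ᶠ-punchIn (suc y) (suc a) (suc b) = <ᶠ-punchIn y a b

≤ᵇ-punchIn-below : ∀ {m} (y : Fin (suc m)) (v : Fin m) t → t ≤ toℕ y →
                   (t ≤ᵇ toℕ (punchIn y v)) ≡ (t ≤ᵇ toℕ v)
≤ᵇ-punchIn-below zero    v       zero    _         = refl
≤ᵇ-punchIn-below (suc y) zero    t       _         = refl
≤ᵇ-punchIn-below (suc y) (suc v) zero    _         = refl
≤ᵇ-punchIn-below (suc y) (suc v) (suc t) (s≤s t≤y) =
  trans (≤ᵇ-suc t (toℕ (punchIn y v)))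
        (trans (≤ᵇ-punchIn-below y v t t≤y) (sym (≤ᵇ-suc t _)))

≤ᵇ-punchIn-above : ∀ {m} (y : Fin (suc m)) (v : Fin m) t → toℕ y ≤ t →
                   (suc t ≤ᵇ toℕ (punchIn y v)) ≡ (t ≤ᵇ toℕ v)
≤ᵇ-punchIn-above zero    v       t       _         = ≤ᵇ-suc t (toℕ v)
≤ᵇ-punchIn-above (suc y) zero    (suc t) _         = refl
≤ᵇ-punchIn-above (suc y) (suc v) (suc t) (s≤s y≤t) =
  trans (≤ᵇ-suc (suc t) (toℕ (punchIn y v)))
        (trans (≤ᵇ-punchIn-above y v t y≤t) (sym (≤ᵇ-suc t _)))

<ᵇ-punchIn-pivot : ∀ {m} (y : Fin (suc m)) (v : Fin m) →
                   (toℕ (punchIn y v) <ᵇ toℕ y) ≡ (toℕ v <ᵇ toℕ y)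
<ᵇ-punchIn-pivot zero    v       = refl
<ᵇ-punchIn-pivot (suc y) zero    = refl
<ᵇ-punchIn-pivot (suc y) (suc v) = <ᵇ-punchIn-pivot y v

toℕ-punchIn-below : ∀ {m} (y : Fin (suc m)) (v : Fin m) →
                    toℕ v < toℕ y → toℕ (punchIn y v) ≡ toℕ v
toℕ-punchIn-below (suc y) zero    _         = refl
toℕ-punchIn-below (suc y) (suc v) (s≤s v<y) = cong suc (toℕ-punchIn-below y v v<y)

inRange-punchIn : ∀ {m} (y : Fin (suc m)) (v : Fin m) s →
                  (s ≤ᵇ toℕ (punchIn y v)) ∧ (toℕ (punchIn y v) <ᵇ toℕ y)
                  ≡ (s ≤ᵇ toℕ v) ∧ (toℕ v <ᵇ toℕ y)
inRange-punchIn y v s rewrite <ᵇ-punchIn-pivot y v with toℕ v ℕ.<? toℕ y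
... | yes v<y rewrite toℕ-punchIn-below y v v<y = refl
... | no  v≮y rewrite dec-false (toℕ v ℕ.<? toℕ y) v≮y = trans (∧-zeroʳ _) (sym (∧-zeroʳ _))

module _ {n m : ℕ} (τ : Fin n → Fin m) where

  atLeast : ℕ → ℕ
  atLeast t = ∑[ j ∈ allFin n ] ⟦ t ≤ᵇ toℕ (τ j) ⟧

  inRange : ℕ → ℕ → ℕ
  inRange s t = ∑[ j ∈ allFin n ] ⟦ (s ≤ᵇ toℕ (τ j)) ∧ (toℕ (τ j) <ᵇ t) ⟧

  inRange+atLeast : ∀ {s t} → s ≤ t → inRange s t + atLeast t ≡ atLeast s
  inRange+atLeast {s} {t} s≤t =
    trans (sym (∑-distrib-+ (allFin n) _ _)) (∑-cong (allFin n) (λ j → split (toℕ (τ j))))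
    where
    split : ∀ v → ⟦ (s ≤ᵇ v) ∧ (v <ᵇ t) ⟧ + ⟦ t ≤ᵇ v ⟧ ≡ ⟦ s ≤ᵇ v ⟧
    split v with v ℕ.<? t
    ... | yes v<t rewrite dec-true (v ℕ.<? t) v<t | dec-false (t ℕ.≤? v) (<⇒≱ v<t) =
      trans (+-identityʳ _) (cong ⟦_⟧ (∧-identityʳ (s ≤ᵇ v)))
    ... | no v≮t rewrite dec-false (v ℕ.<? t) v≮t
                       | dec-true (t ℕ.≤? v) (≮⇒≥ v≮t)
                       | dec-true (s ℕ.≤? v) (≤-trans s≤t (≮⇒≥ v≮t)) = refl

  inRange-empty : ∀ {s t} → t ≤ s → inRange s t ≡ 0
  inRange-empty {s} {t} t≤s = ∑-zero (allFin n) (λ j → cong ⟦_⟧ (empty (toℕ (τ j))))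
    where
    empty : ∀ v → (s ≤ᵇ v) ∧ (v <ᵇ t) ≡ false
    empty v with s ℕ.≤? v
    ... | yes s≤v rewrite dec-true (s ℕ.≤? v) s≤v =
      dec-false (v ℕ.<? t) (≤⇒≯ (≤-trans t≤s s≤v))
    ... | no  s≰v rewrite dec-false (s ℕ.≤? v) s≰v = refl

  inversionsFrom : ℕ → ℕ
  inversionsFrom t = #pairs (λ j k → (t ≤ᵇ toℕ (τ k)) ∧ (τ k <ᶠ τ j))

  noninversionsFrom : ℕ → ℕ
  noninversionsFrom t = #pairs (λ j k → (t ≤ᵇ toℕ (τ j)) ∧ (τ j <ᶠ τ k))

module _ {n m : ℕ} (τ : Fin n → Fin m) (τ-injective : Injective _≡_ _≡_ τ) where

  inversionsFrom+noninversionsFrom : ∀ t →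
    inversionsFrom τ t + noninversionsFrom τ t ≡ atLeast τ t C 2
  inversionsFrom+noninversionsFrom t = begin
    inversionsFrom τ t + noninversionsFrom τ t
      ≡⟨ ∑-distrib-+ (allFin n) _ _ ⟨
    ∑[ j ∈ allFin n ] (∑[ k ∈ allFin n ] inv j k + ∑[ k ∈ allFin n ] noninv j k)
      ≡⟨ ∑-cong (allFin n) (λ j →
           trans (sym (∑-distrib-+ (allFin n) _ _)) (∑-cong (allFin n) (pair j))) ⟩
    #pairs (λ j k → (t ≤ᵇ toℕ (τ j)) ∧ (t ≤ᵇ toℕ (τ k)))
      ≡⟨ #pairs-both (λ j → t ≤ᵇ toℕ (τ j)) ⟩
    atLeast τ t C 2 ∎
    where
    open ≡-Reasoning
    inv noninv : Fin n → Fin n → ℕ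
    inv    j k = ⟦ (j <ᶠ k) ∧ (t ≤ᵇ toℕ (τ k)) ∧ (τ k <ᶠ τ j) ⟧
    noninv j k = ⟦ (j <ᶠ k) ∧ (t ≤ᵇ toℕ (τ j)) ∧ (τ j <ᶠ τ k) ⟧
    pair : ∀ j k → inv j k + noninv j k ≡ ⟦ (j <ᶠ k) ∧ (t ≤ᵇ toℕ (τ j)) ∧ (t ≤ᵇ toℕ (τ k)) ⟧
    pair j k with j Fin.<? k
    ... | no  j≮k rewrite dec-false (j Fin.<? k) j≮k = refl
    ... | yes j<k rewrite dec-true (j Fin.<? k) j<k with <-cmp (toℕ (τ j)) (toℕ (τ k))
    ...   | tri≈ _ τj≡τk _ = ⊥-elim (Finₚ.<⇒≢ j<k (τ-injective (Finₚ.toℕ-injective τj≡τk)))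
    ...   | tri< τj<τk _ _ rewrite dec-false (toℕ (τ k) ℕ.<? toℕ (τ j)) (<⇒≯ τj<τk)
                                 | dec-true (toℕ (τ j) ℕ.<? toℕ (τ k)) τj<τk =
      cong₂ (λ a b → ⟦ a ⟧ + ⟦ b ⟧) (∧-zeroʳ (t ≤ᵇ toℕ (τ k)))
            (trans (∧-identityʳ _) (sym (≤ᵇ-∧-≤ᵇ t (<⇒≤ τj<τk))))
    ...   | tri> _ _ τk<τj rewrite dec-true (toℕ (τ k) ℕ.<? toℕ (τ j)) τk<τj
                                 | dec-false (toℕ (τ j) ℕ.<? toℕ (τ k)) (<⇒≯ τk<τj) =
      trans (cong₂ (λ a b → ⟦ a ⟧ + ⟦ b ⟧) (∧-identityʳ _) (∧-zeroʳ (t ≤ᵇ toℕ (τ j))))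
            (trans (+-identityʳ _)
                   (cong ⟦_⟧ (sym (trans (∧-comm (t ≤ᵇ toℕ (τ j)) _) (≤ᵇ-∧-≤ᵇ t (<⇒≤ τk<τj))))))

inversionsFrom-high : ∀ {n m} (τ : Fin n → Fin m) t → m ≤ suc t → inversionsFrom τ t ≡ 0
inversionsFrom-high {n} τ t m≤1+t = ∑-zero (allFin n) (λ j → ∑-zero (allFin n) (λ k →
  cong ⟦_⟧ (trans (cong ((j <ᶠ k) ∧_) (noInversion (τ j) (τ k))) (∧-zeroʳ (j <ᶠ k)))))
  where
  noInversion : ∀ a b → (t ≤ᵇ toℕ b) ∧ (b <ᶠ a) ≡ false
  noInversion a b with t ℕ.≤? toℕ b
  ... | no  t≰b rewrite dec-false (t ℕ.≤? toℕ b) t≰b = refl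
  ... | yes t≤b rewrite dec-true (t ℕ.≤? toℕ b) t≤b =
    dec-false (b Fin.<? a) (≤⇒≯ (s≤s⁻¹ (≤-trans (toℕ<n a) (≤-trans m≤1+t (s≤s t≤b)))))

Balanced : ∀ {n} → (Fin n → Fin n) → Set
Balanced {n} τ = ∀ t → t ≤ n → atLeast τ t ≡ n ∸ t

noninversionsFrom-sorted : ∀ {n} (τ : Fin n → Fin n) → Injective _≡_ _≡_ τ → Balanced τ →
                           ∀ {t} → t ≤ n → inversionsFrom τ t ≡ 0 →
                           noninversionsFrom τ t ≡ (n ∸ t) C 2
noninversionsFrom-sorted {n} τ τ-inj τ-bal {t} t≤n τ-sorted = begin
  noninversionsFrom τ t                       ≡⟨ cong (_+ noninversionsFrom τ t) τ-sorted ⟨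
  inversionsFrom τ t + noninversionsFrom τ t  ≡⟨ inversionsFrom+noninversionsFrom τ τ-inj t ⟩
  atLeast τ t C 2                             ≡⟨ cong (_C 2) (τ-bal t t≤n) ⟩
  (n ∸ t) C 2                                 ∎
  where open ≡-Reasoning

module _ {n : ℕ} (x : Fin (suc n)) (τ : Fin n → Fin n) where

  private
    <ᶠ-lift : ∀ j k → (lift x τ j <ᶠ lift x τ k) ≡ (τ j <ᶠ τ k)
    <ᶠ-lift j k =
      trans (cong₂ _<ᶠ_ (lift-apply x τ j) (lift-apply x τ k)) (<ᶠ-punchIn x (τ j) (τ k))

    ≤ᵇ-lift-below : ∀ t j → t ≤ toℕ x → (t ≤ᵇ toℕ (lift x τ j)) ≡ (t ≤ᵇ toℕ (τ j))
    ≤ᵇ-lift-below t j t≤x =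
      trans (cong (λ v → t ≤ᵇ toℕ v) (lift-apply x τ j)) (≤ᵇ-punchIn-below x (τ j) t t≤x)

    ≤ᵇ-lift-above : ∀ t j → toℕ x ≤ t → (suc t ≤ᵇ toℕ (lift x τ j)) ≡ (t ≤ᵇ toℕ (τ j))
    ≤ᵇ-lift-above t j x≤t =
      trans (cong (λ v → suc t ≤ᵇ toℕ v) (lift-apply x τ j)) (≤ᵇ-punchIn-above x (τ j) t x≤t)

  occ132-◃ : occ132 (x ◃ τ) ≡ inversionsFrom τ (toℕ x) + occ132 τ
  occ132-◃ = trans (occ132≡#triples (x ◃ τ)) (trans (#triples-suc (forms132 (x ◃ τ))) (cong₂ _+_
    (#pairs-cong (λ j k → cong₂ _∧_ (≤ᵇ-lift-above (toℕ x) k ≤-refl) (<ᶠ-lift k j)))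
    (trans (#triples-cong (λ i j k → cong₂ _∧_ (<ᶠ-lift i k) (<ᶠ-lift k j)))
           (sym (occ132≡#triples τ)))))

  occ123-◃ : occ123 (x ◃ τ) ≡ noninversionsFrom τ (toℕ x) + occ123 τ
  occ123-◃ = trans (occ123≡#triples (x ◃ τ)) (trans (#triples-suc (forms123 (x ◃ τ))) (cong₂ _+_
    (#pairs-cong (λ j k → cong₂ _∧_ (≤ᵇ-lift-above (toℕ x) j ≤-refl) (<ᶠ-lift j k)))
    (trans (#triples-cong (λ i j k → cong₂ _∧_ (<ᶠ-lift i j) (<ᶠ-lift j k)))
           (sym (occ123≡#triples τ)))))

  atLeast-◃-below : ∀ t → t ≤ toℕ x → atLeast (x ◃ τ) t ≡ suc (atLeast τ t)
  atLeast-◃-below t t≤x = trans (∑-allFin-suc n (λ j → ⟦ t ≤ᵇ toℕ ((x ◃ τ) j) ⟧))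
    (cong₂ _+_ (cong ⟦_⟧ (dec-true (t ℕ.≤? toℕ x) t≤x))
               (∑-cong (allFin n) (λ j → cong ⟦_⟧ (≤ᵇ-lift-below t j t≤x))))

  atLeast-◃-above : ∀ t → toℕ x ≤ t → atLeast (x ◃ τ) (suc t) ≡ atLeast τ t
  atLeast-◃-above t x≤t = trans (∑-allFin-suc n (λ j → ⟦ suc t ≤ᵇ toℕ ((x ◃ τ) j) ⟧))
    (cong₂ _+_ (cong ⟦_⟧ (dec-false (suc t ℕ.≤? toℕ x) (≤⇒≯ x≤t)))
               (∑-cong (allFin n) (λ j → cong ⟦_⟧ (≤ᵇ-lift-above t j x≤t))))

  balanced-◃ : Balanced τ → Balanced (x ◃ τ)
  balanced-◃ τ-balanced t t≤1+n with t ℕ.≤? toℕ x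
  ... | yes t≤x = trans (atLeast-◃-below t t≤x)
    (trans (cong suc (τ-balanced t (≤-trans t≤x x≤n))) (sym (+-∸-assoc 1 (≤-trans t≤x x≤n))))
    where x≤n = s≤s⁻¹ (toℕ<n x)
  balanced-◃ τ-balanced zero    _       | no t≰x = ⊥-elim (t≰x z≤n)
  balanced-◃ τ-balanced (suc t) 1+t≤1+n | no t≰x =
    trans (atLeast-◃-above t (s≤s⁻¹ (≰⇒> t≰x))) (τ-balanced t (s≤s⁻¹ 1+t≤1+n))

  injective-◃ : Injective _≡_ _≡_ τ → Injective _≡_ _≡_ (x ◃ τ)
  injective-◃ τ-injective {zero}  {zero}  _   = refl
  injective-◃ τ-injective {zero}  {suc k} x≡ =
    ⊥-elim (punchInᵢ≢i x (τ k) (sym (trans x≡ (lift-apply x τ k))))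
  injective-◃ τ-injective {suc j} {zero}  ≡x =
    ⊥-elim (punchInᵢ≢i x (τ j) (trans (sym (lift-apply x τ j)) ≡x))
  injective-◃ τ-injective {suc j} {suc k} eq = cong suc (τ-injective (punchIn-injective x (τ j) (τ k)
    (trans (sym (lift-apply x τ j)) (trans eq (lift-apply x τ k)))))

  inversionsFrom-◃ : ∀ y → inversionsFrom (x ◃ τ) y
                           ≡ inRange τ y (toℕ x)
                             + #pairs (λ j k → (y ≤ᵇ toℕ (lift x τ k)) ∧ (τ k <ᶠ τ j))
  inversionsFrom-◃ y = trans (#pairs-suc (λ j k → (y ≤ᵇ toℕ ((x ◃ τ) k)) ∧ ((x ◃ τ) k <ᶠ (x ◃ τ) j)))
    (cong₂ _+_ (∑-cong (allFin n) (λ k → cong ⟦_⟧ (trans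
                  (cong (λ v → (y ≤ᵇ toℕ v) ∧ (toℕ v <ᵇ toℕ x)) (lift-apply x τ k))
                  (inRange-punchIn x (τ k) y))))
               (#pairs-cong (λ j k → cong ((y ≤ᵇ toℕ (lift x τ k)) ∧_) (<ᶠ-lift k j))))

  inversionsFrom-◃-vanishes : ∀ y → toℕ x ≤ y → inversionsFrom τ (toℕ x) ≡ 0 →
                              inversionsFrom (x ◃ τ) y ≡ 0
  inversionsFrom-◃-vanishes y x≤y τ-sorted = n≤0⇒n≡0 (begin
    inversionsFrom (x ◃ τ) y  ≡⟨ inversionsFrom-◃ y ⟩
    inRange τ y (toℕ x) + R   ≡⟨ cong (_+ R) (inRange-empty τ x≤y) ⟩
    R                         ≤⟨ #pairs-mono narrow ⟩
    inversionsFrom τ (toℕ x)  ≡⟨ τ-sorted ⟩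
    0                         ∎)
    where
    open ≤-Reasoning
    R = #pairs (λ j k → (y ≤ᵇ toℕ (lift x τ k)) ∧ (τ k <ᶠ τ j))
    narrow : ∀ j k → T ((y ≤ᵇ toℕ (lift x τ k)) ∧ (τ k <ᶠ τ j)) →
                     T ((toℕ x ≤ᵇ toℕ (τ k)) ∧ (τ k <ᶠ τ j))
    narrow j k with y ℕ.≤? toℕ (lift x τ k)
    ... | no  y≰ rewrite dec-false (y ℕ.≤? toℕ (lift x τ k)) y≰ = λ ()
    ... | yes y≤ rewrite dec-true (y ℕ.≤? toℕ (lift x τ k)) y≤
                       | sym (≤ᵇ-lift-below (toℕ x) k ≤-refl)
                       | dec-true (toℕ x ℕ.≤? toℕ (lift x τ k)) (≤-trans x≤y y≤) = λ τk<τj → τk<τj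

  inversionsFrom-◃-nonzero : Balanced τ → ∀ y → y < toℕ x → inversionsFrom (x ◃ τ) y ≢ 0
  inversionsFrom-◃-nonzero τ-balanced y y<x I≡0 =
    <⇒≢ y<x (sym (∸-cancelˡ-≡ x≤n y≤n (begin
      n ∸ toℕ x                                ≡⟨ τ-balanced (toℕ x) x≤n ⟨
      atLeast τ (toℕ x)                        ≡⟨ cong (_+ atLeast τ (toℕ x)) range≡0 ⟨
      inRange τ y (toℕ x) + atLeast τ (toℕ x)  ≡⟨ inRange+atLeast τ (<⇒≤ y<x) ⟩
      atLeast τ y                              ≡⟨ τ-balanced y y≤n ⟩
      n ∸ y                                    ∎)))
    where
    open ≡-Reasoning
    x≤n = s≤s⁻¹ (toℕ<n x)
    y≤n = ≤-trans (<⇒≤ y<x) x≤n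
    range≡0 : inRange τ y (toℕ x) ≡ 0
    range≡0 = m+n≡0⇒m≡0 _ (trans (sym (inversionsFrom-◃ y)) I≡0)

  inversionsFrom-◃≡ᵇ0 : Balanced τ → inversionsFrom τ (toℕ x) ≡ 0 →
                        ∀ y → (inversionsFrom (x ◃ τ) y ≡ᵇ 0) ≡ (toℕ x ≤ᵇ y)
  inversionsFrom-◃≡ᵇ0 τ-balanced τ-sorted y with toℕ x ℕ.≤? y
  ... | yes x≤y rewrite dec-true (toℕ x ℕ.≤? y) x≤y
                      | inversionsFrom-◃-vanishes y x≤y τ-sorted = refl
  ... | no  x≰y rewrite dec-false (toℕ x ℕ.≤? y) x≰y =
    dec-false (inversionsFrom (x ◃ τ) y ℕ.≟ 0) (inversionsFrom-◃-nonzero τ-balanced y (≰⇒> x≰y))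

∑-perms-cong : ∀ n {F G : (Fin n → Fin n) → ℕ} →
               (∀ τ → Injective _≡_ _≡_ τ → Balanced τ → F τ ≡ G τ) →
               ∑ (perms n) F ≡ ∑ (perms n) G
∑-perms-cong zero    F≗G = cong (_+ 0) (F≗G _ (λ { {()} }) (λ { .0 z≤n → refl }))
∑-perms-cong (suc n) {F} {G} F≗G = begin
  ∑ (perms (suc n)) F
    ≡⟨ ∑-perms-suc n F ⟩
  ∑[ x ∈ allFin (suc n) ] ∑[ τ ∈ perms n ] F (x ◃ τ)
    ≡⟨ ∑-cong (allFin (suc n)) (λ x → ∑-perms-cong n (λ τ τ-inj τ-bal →
         F≗G (x ◃ τ) (injective-◃ x τ τ-inj) (balanced-◃ x τ τ-bal))) ⟩
  ∑[ x ∈ allFin (suc n) ] ∑[ τ ∈ perms n ] G (x ◃ τ)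
    ≡⟨ ∑-perms-suc n G ⟨
  ∑ (perms (suc n)) G ∎
  where open ≡-Reasoning

-- Counting 132-avoiders with at most two 123s

#avoiders : ℕ → ℕ → ℕ → ℕ
#avoiders n c y =
  ∑[ τ ∈ perms n ] (⟦ inversionsFrom τ y ≡ᵇ 0 ⟧ * ⟦ occ132 τ ≡ᵇ 0 ⟧ * ⟦ occ123 τ ≡ᵇ c ⟧)

#avoiders-high : ∀ n c y → n ≤ suc y →
                 #avoiders n c y ≡ ∑[ τ ∈ perms n ] (⟦ occ132 τ ≡ᵇ 0 ⟧ * ⟦ occ123 τ ≡ᵇ c ⟧)
#avoiders-high n c y n≤1+y = ∑-cong (perms n) (λ τ → trans
  (cong (λ i → ⟦ i ≡ᵇ 0 ⟧ * ⟦ occ132 τ ≡ᵇ 0 ⟧ * ⟦ occ123 τ ≡ᵇ c ⟧) (inversionsFrom-high τ y n≤1+y))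
  (cong (_* ⟦ occ123 τ ≡ᵇ c ⟧) (*-identityˡ ⟦ occ132 τ ≡ᵇ 0 ⟧)))

module _ {n : ℕ} (c y : ℕ) (x : Fin (suc n)) where

  private
    K = (n ∸ toℕ x) C 2

  ◃-indicators : ∀ τ → Injective _≡_ _≡_ τ → Balanced τ →
    ⟦ inversionsFrom (x ◃ τ) y ≡ᵇ 0 ⟧ * ⟦ occ132 (x ◃ τ) ≡ᵇ 0 ⟧ * ⟦ occ123 (x ◃ τ) ≡ᵇ c ⟧
    ≡ ⟦ toℕ x ≤ᵇ y ⟧ * ⟦ K ≤ᵇ c ⟧
      * (⟦ inversionsFrom τ (toℕ x) ≡ᵇ 0 ⟧ * ⟦ occ132 τ ≡ᵇ 0 ⟧ * ⟦ occ123 τ ≡ᵇ c ∸ K ⟧)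
  ◃-indicators τ τ-inj τ-bal rewrite occ132-◃ x τ | occ123-◃ x τ
    with inversionsFrom τ (toℕ x) in τ-sorted
  ... | suc _ =
    trans (cong (_* ⟦ noninversionsFrom τ (toℕ x) + occ123 τ ≡ᵇ c ⟧)
                (*-zeroʳ ⟦ inversionsFrom (x ◃ τ) y ≡ᵇ 0 ⟧))
          (sym (*-zeroʳ (⟦ toℕ x ≤ᵇ y ⟧ * ⟦ K ≤ᵇ c ⟧)))
  ... | zero rewrite inversionsFrom-◃≡ᵇ0 x τ τ-bal τ-sorted y
                   | noninversionsFrom-sorted τ τ-inj τ-bal (s≤s⁻¹ (toℕ<n x)) τ-sorted
                   | ⟦+≡ᵇ⟧ K (occ123 τ) c =
    rearrange ⟦ toℕ x ≤ᵇ y ⟧ ⟦ occ132 τ ≡ᵇ 0 ⟧ ⟦ K ≤ᵇ c ⟧ ⟦ occ123 τ ≡ᵇ c ∸ K ⟧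
    where
    rearrange : ∀ p a k b → p * a * (k * b) ≡ p * k * (1 * a * b)
    rearrange = solve-∀

#avoiders-suc : ∀ n c y → #avoiders (suc n) c y ≡
  ∑[ x ∈ allFin (suc n) ]
    (⟦ toℕ x ≤ᵇ y ⟧ * ⟦ (n ∸ toℕ x) C 2 ≤ᵇ c ⟧ * #avoiders n (c ∸ (n ∸ toℕ x) C 2) (toℕ x))
#avoiders-suc n c y = trans (∑-perms-suc n _) (∑-cong (allFin (suc n)) (λ x →
  trans (∑-perms-cong n (◃-indicators c y x))
        (∑-*ˡ (perms n) (⟦ toℕ x ≤ᵇ y ⟧ * ⟦ (n ∸ toℕ x) C 2 ≤ᵇ c ⟧) _)))

full sortedTop : ℕ → ℕ → ℕ
full      c m = #avoiders (2 + m) c (2 + m)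
sortedTop c m = #avoiders (2 + m) c m

#avoiders-3+ : ∀ m c y → c ≤ 2 → #avoiders (3 + m) c y ≡
  ⟦ m ≤ᵇ y ⟧ * (⟦ 1 ≤ᵇ c ⟧ * sortedTop (c ∸ 1) m)
  + ⟦ 1 + m ≤ᵇ y ⟧ * full c m + ⟦ 2 + m ≤ᵇ y ⟧ * full c m
#avoiders-3+ m c y c≤2 = begin
  #avoiders (3 + m) c y
    ≡⟨ #avoiders-suc (2 + m) c y ⟩
  ∑[ x ∈ allFin (3 + m) ] term (toℕ x)
    ≡⟨ ∑-allFin-last3 m term far≡0 ⟩
  term m + term (1 + m) + term (2 + m)
    ≡⟨ cong₂ _+_ (cong₂ _+_ (trans (cong (term′ m) (m+n∸n≡m 2 m)) (*-assoc ⟦ m ≤ᵇ y ⟧ _ _))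
                            (trans (cong (term′ (1 + m)) (m+n∸n≡m 1 m))
                                   (cong₂ _*_ (*-identityʳ ⟦ 1 + m ≤ᵇ y ⟧) full-below)))
                 (trans (cong (term′ (2 + m)) (n∸n≡0 m))
                        (cong (_* full c m) (*-identityʳ ⟦ 2 + m ≤ᵇ y ⟧))) ⟩
  ⟦ m ≤ᵇ y ⟧ * (⟦ 1 ≤ᵇ c ⟧ * sortedTop (c ∸ 1) m)
  + ⟦ 1 + m ≤ᵇ y ⟧ * full c m + ⟦ 2 + m ≤ᵇ y ⟧ * full c m ∎
  where
  open ≡-Reasoning
  full-below : #avoiders (2 + m) c (1 + m) ≡ full c m
  full-below = trans (#avoiders-high (2 + m) c (1 + m) ≤-refl)
                     (sym (#avoiders-high (2 + m) c (2 + m) (n≤1+n _)))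
  term′ : ℕ → ℕ → ℕ
  term′ x d = ⟦ x ≤ᵇ y ⟧ * ⟦ d C 2 ≤ᵇ c ⟧ * #avoiders (2 + m) (c ∸ d C 2) x
  term : ℕ → ℕ
  term x = term′ x (2 + m ∸ x)
  far≡0 : ∀ x → x < m → term x ≡ 0
  far≡0 x x<m = trans (cong (λ b → ⟦ x ≤ᵇ y ⟧ * b * #avoiders (2 + m) (c ∸ (2 + m ∸ x) C 2) x)
    (⟦≰ᵇ⟧ (≤-trans (s≤s c≤2) (3≤C2 (m+n≤o⇒m≤o∸n 3 (s≤s (s≤s x<m)))))))
    (cong (_* #avoiders (2 + m) (c ∸ (2 + m ∸ x) C 2) x) (*-zeroʳ ⟦ x ≤ᵇ y ⟧))

full-suc : ∀ c m → c ≤ 2 → full c (suc m) ≡ ⟦ 1 ≤ᵇ c ⟧ * sortedTop (c ∸ 1) m + 2 * full c m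
full-suc c m c≤2 = begin
  full c (suc m)
    ≡⟨ #avoiders-3+ m c (3 + m) c≤2 ⟩
  ⟦ m ≤ᵇ 3 + m ⟧ * B + ⟦ 1 + m ≤ᵇ 3 + m ⟧ * full c m + ⟦ 2 + m ≤ᵇ 3 + m ⟧ * full c m
    ≡⟨ cong₂ _+_ (cong₂ _+_ (cong (_* B) (⟦≤ᵇ⟧ (m≤n+m m 3)))
                            (cong (_* full c m) (⟦≤ᵇ⟧ (m≤n+m (1 + m) 2))))
                 (cong (_* full c m) (⟦≤ᵇ⟧ (m≤n+m (2 + m) 1))) ⟩
  1 * B + 1 * full c m + 1 * full c m
    ≡⟨ simplify B (full c m) ⟩
  B + 2 * full c m ∎
  where
  open ≡-Reasoning
  B = ⟦ 1 ≤ᵇ c ⟧ * sortedTop (c ∸ 1) m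
  simplify : ∀ b f → 1 * b + 1 * f + 1 * f ≡ b + 2 * f
  simplify = solve-∀

sortedTop-suc : ∀ c m → c ≤ 2 → sortedTop c (suc m) ≡ ⟦ 1 ≤ᵇ c ⟧ * sortedTop (c ∸ 1) m + full c m
sortedTop-suc c m c≤2 = begin
  sortedTop c (suc m)
    ≡⟨ #avoiders-3+ m c (1 + m) c≤2 ⟩
  ⟦ m ≤ᵇ 1 + m ⟧ * B + ⟦ 1 + m ≤ᵇ 1 + m ⟧ * full c m + ⟦ 2 + m ≤ᵇ 1 + m ⟧ * full c m
    ≡⟨ cong₂ _+_ (cong₂ _+_ (cong (_* B) (⟦≤ᵇ⟧ (n≤1+n m)))
                            (cong (_* full c m) (⟦≤ᵇ⟧ (≤-refl {1 + m}))))
                 (cong (_* full c m) (⟦≰ᵇ⟧ (≤-refl {2 + m}))) ⟩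
  1 * B + 1 * full c m + 0 * full c m
    ≡⟨ simplify B (full c m) ⟩
  B + full c m ∎
  where
  open ≡-Reasoning
  B = ⟦ 1 ≤ᵇ c ⟧ * sortedTop (c ∸ 1) m
  simplify : ∀ b f → 1 * b + 1 * f + 0 * f ≡ b + f
  simplify = solve-∀

State : Set
State = ℕ × ℕ × ℕ × ℕ × ℕ

state : ℕ → State
state m = full 2 m , sortedTop 1 m , full 1 m , sortedTop 0 m , full 0 m

step : State → State
step (u , p , q , r , s) = p + 2 * u , r + q , r + 2 * q , s , 2 * s

state-suc : ∀ m → state (suc m) ≡ step (state m)
state-suc m =
  cong₂ _,_ (trans (full-suc 2 m ≤-refl) (cong (_+ 2 * full 2 m) (*-identityˡ (sortedTop 1 m))))
  (cong₂ _,_ (trans (sortedTop-suc 1 m (s≤s z≤n)) (cong (_+ full 1 m) (*-identityˡ (sortedTop 0 m))))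
  (cong₂ _,_ (trans (full-suc 1 m (s≤s z≤n)) (cong (_+ 2 * full 1 m) (*-identityˡ (sortedTop 0 m))))
  (cong₂ _,_ (sortedTop-suc 0 m z≤n) (full-suc 0 m z≤n))))

initialState : State
initialState = 0 , 0 , 0 , 1 , 2

state≡fold : ∀ m → state m ≡ fold initialState step m
state≡fold zero    = refl
state≡fold (suc m) = trans (state-suc m) (cong step (state≡fold m))

a≡#avoiders : ∀ n → a n ≡ #avoiders n 2 n
a≡#avoiders n = begin
  a n
    ≡⟨ countᵇ≡∑ _ (perms n) ⟩
  ∑[ π ∈ perms n ] ⟦ (occ132 π ≡ᵇ 0) ∧ (occ123 π ≡ᵇ 2) ⟧
    ≡⟨ ∑-cong (perms n) (λ π → ⟦∧⟧ (occ132 π ≡ᵇ 0) _) ⟩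
  ∑[ π ∈ perms n ] (⟦ occ132 π ≡ᵇ 0 ⟧ * ⟦ occ123 π ≡ᵇ 2 ⟧)
    ≡⟨ #avoiders-high n 2 n (n≤1+n n) ⟨
  #avoiders n 2 n ∎
  where open ≡-Reasoning

a′ : ℕ → ℕ
a′ 0             = 0
a′ 1             = 0
a′ (suc (suc m)) = proj₁ (fold initialState step m)

a≡a′ : ∀ n → a n ≡ a′ n
a≡a′ 0             = refl
a≡a′ 1             = refl
a≡a′ (suc (suc m)) = trans (a≡#avoiders (2 + m)) (cong proj₁ (state≡fold m))

-- The characteristic polynomial of `step` is λ²(λ-2)³.
step-annihilated : ∀ s → proj₁ (fold s step 5) + 12 * proj₁ (fold s step 3)
                         ≡ 6 * proj₁ (fold s step 4) + 8 * proj₁ (fold s step 2)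
step-annihilated (u , p , q , r , s) = identity u p q r s
  where
  identity : ∀ u p q r s →
    let t₂ = r + q + 2 * (p + 2 * u)
        t₃ = s + (r + 2 * q) + 2 * t₂
        t₄ = 2 * s + (s + 2 * (r + 2 * q)) + 2 * t₃
        t₅ = 2 * (2 * s) + (2 * s + 2 * (s + 2 * (r + 2 * q))) + 2 * t₄
    in t₅ + 12 * t₃ ≡ 6 * t₄ + 8 * t₂
  identity = solve-∀

a′-recurrence : ∀ k → a′ (7 + k) + 12 * a′ (5 + k) ≡ 6 * a′ (6 + k) + 8 * a′ (4 + k)
a′-recurrence k = step-annihilated (fold initialState step k)

-- The generating function

⋆-sucˡ : ∀ (f g : Series) n → (f ⋆ g) (suc n) ≡ f 0 ℤ.* g (suc n) ℤ.+ ((f ∘ suc) ⋆ g) n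
⋆-sucˡ f g n = cong (ℤ._+_ (f 0 ℤ.* g (suc n))) (trans
  (cong sumℤ (map-applyUpTo suc (λ k → f k ℤ.* g (suc n ∸ k)) (suc n)))
  (sym (cong sumℤ (map-applyUpTo (λ k → k) (λ k → f (suc k) ℤ.* g (n ∸ k)) (suc n)))))

⋆-congˡ : ∀ {f f′ : Series} (g : Series) → (∀ k → f k ≡ f′ k) →
          ∀ n → (f ⋆ g) n ≡ (f′ ⋆ g) n
⋆-congˡ g f≗f′ n =
  cong sumℤ (map-cong (λ k → cong (ℤ._* g (n ∸ k)) (f≗f′ k)) (upTo (suc n)))

record VanishesFrom (d : ℕ) (f : Series) : Set where
  constructor vanishesFrom
  field vanishes : ∀ k → f (d + k) ≡ ℤ.+ 0
open VanishesFrom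

⋆-zeroˡ : ∀ {f} (g : Series) → (∀ k → f k ≡ ℤ.+ 0) → ∀ n → (f ⋆ g) n ≡ ℤ.+ 0
⋆-zeroˡ {f} g f≡0 zero    = cong (λ v → v ℤ.* g 0 ℤ.+ ℤ.+ 0) (f≡0 0)
⋆-zeroˡ {f} g f≡0 (suc n) = trans (⋆-sucˡ f g n)
  (cong₂ (λ v w → v ℤ.* g (suc n) ℤ.+ w) (f≡0 0) (⋆-zeroˡ g (f≡0 ∘ suc) n))

⋆-vanishes : ∀ {f g} a b → VanishesFrom (suc a) f → VanishesFrom (suc b) g →
             VanishesFrom (suc (a + b)) (f ⋆ g)
⋆-vanishes {f} {g} zero b f≡0 g≡0 = vanishesFrom λ k → trans (⋆-sucˡ f g (b + k))
  (cong₂ ℤ._+_ (trans (cong (f 0 ℤ.*_) (vanishes g≡0 k)) (ℤₚ.*-zeroʳ (f 0)))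
               (⋆-zeroˡ {f ∘ suc} g (vanishes f≡0) (b + k)))
⋆-vanishes {f} {g} (suc a) b f≡0 g≡0 = vanishesFrom λ k → trans (⋆-sucˡ f g (suc (a + b) + k))
  (cong₂ ℤ._+_ (trans (cong (λ i → f 0 ℤ.* g i) (index a b k))
                      (trans (cong (f 0 ℤ.*_) (vanishes g≡0 (suc a + k))) (ℤₚ.*-zeroʳ (f 0))))
               (vanishes (⋆-vanishes {f ∘ suc} {g} a b (vanishesFrom (vanishes f≡0)) g≡0) k))
  where
  index : ∀ a b k → suc (suc (a + b) + k) ≡ suc b + (suc a + k)
  index = solve-∀

⋆-window : ∀ g d → VanishesFrom (suc d) g →
           ∀ f m → (f ⋆ g) (m + d) ≡ ((λ k → f (k + m)) ⋆ g) d
⋆-window g d g≡0 f zero    = ⋆-congˡ g (λ k → cong f (sym (+-identityʳ k))) d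
⋆-window g d g≡0 f (suc m) = begin
  (f ⋆ g) (suc m + d)
    ≡⟨ ⋆-sucˡ f g (m + d) ⟩
  f 0 ℤ.* g (suc (m + d)) ℤ.+ ((f ∘ suc) ⋆ g) (m + d)
    ≡⟨ trans (cong (ℤ._+ ((f ∘ suc) ⋆ g) (m + d)) head≡0) (ℤₚ.+-identityˡ _) ⟩
  ((f ∘ suc) ⋆ g) (m + d)
    ≡⟨ ⋆-window g d g≡0 (f ∘ suc) m ⟩
  ((λ k → f (suc (k + m))) ⋆ g) d
    ≡⟨ ⋆-congˡ g (λ k → cong f (sym (+-suc k m))) d ⟩
  ((λ k → f (k + suc m)) ⋆ g) d ∎
  where
  open ≡-Reasoning
  head≡0 : f 0 ℤ.* g (suc (m + d)) ≡ ℤ.+ 0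
  head≡0 = trans (cong (λ i → f 0 ℤ.* g i) (cong suc (+-comm m d)))
                 (trans (cong (f 0 ℤ.*_) (vanishes g≡0 m)) (ℤₚ.*-zeroʳ (f 0)))

cube : Series
cube = (const (ℤ.+ 1) ⊖ (const (ℤ.+ 2) ⋆ z)) ^ˢ 3

const-vanishes : ∀ c → VanishesFrom 1 (const c)
const-vanishes c = vanishesFrom λ k → refl

z-vanishes : VanishesFrom 2 z
z-vanishes = vanishesFrom λ k → refl

cube-vanishes : VanishesFrom 4 cube
cube-vanishes =
  ⋆-vanishes 1 2 linear (⋆-vanishes 1 1 linear (⋆-vanishes 1 0 linear (const-vanishes _)))
  where
  linear : VanishesFrom 2 (const (ℤ.+ 1) ⊖ (const (ℤ.+ 2) ⋆ z))
  linear = vanishesFrom λ k →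
    cong (ℤ._-_ (ℤ.+ 0)) (vanishes (⋆-vanishes 0 1 (const-vanishes (ℤ.+ 2)) z-vanishes) k)

cube-annihilates : ∀ w → w 3 + 12 * w 1 ≡ 6 * w 2 + 8 * w 0 → (ogf w ⋆ cube) 3 ≡ ℤ.+ 0
cube-annihilates w rec = begin
  (ogf w ⋆ cube) 3
    ≡⟨ rearrange (ℤ.+ w 0) (ℤ.+ w 1) (ℤ.+ w 2) (ℤ.+ w 3) ⟩
  (ℤ.+ w 3 ℤ.+ ℤ.+ 12 ℤ.* ℤ.+ w 1) ℤ.- (ℤ.+ 6 ℤ.* ℤ.+ w 2 ℤ.+ ℤ.+ 8 ℤ.* ℤ.+ w 0)
    ≡⟨ cong₂ ℤ._-_ (trans (ℤₚ.pos-+ (w 3) _) (cong (ℤ._+_ (ℤ.+ w 3)) (ℤₚ.pos-* 12 (w 1))))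
                   (trans (ℤₚ.pos-+ (6 * w 2) _) (cong₂ ℤ._+_ (ℤₚ.pos-* 6 (w 2)) (ℤₚ.pos-* 8 (w 0)))) ⟨
  ℤ.+ (w 3 + 12 * w 1) ℤ.- ℤ.+ (6 * w 2 + 8 * w 0)
    ≡⟨ cong (λ v → ℤ.+ v ℤ.- ℤ.+ (6 * w 2 + 8 * w 0)) rec ⟩
  ℤ.+ (6 * w 2 + 8 * w 0) ℤ.- ℤ.+ (6 * w 2 + 8 * w 0)
    ≡⟨ ℤₚ.+-inverseʳ (ℤ.+ (6 * w 2 + 8 * w 0)) ⟩
  ℤ.+ 0 ∎
  where
  open ≡-Reasoning
  rearrange : ∀ p q r s →
    p ℤ.* ℤ.- (ℤ.+ 8) ℤ.+ (q ℤ.* ℤ.+ 12 ℤ.+ (r ℤ.* ℤ.- (ℤ.+ 6) ℤ.+ (s ℤ.* ℤ.+ 1 ℤ.+ ℤ.+ 0)))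
    ≡ (s ℤ.+ ℤ.+ 12 ℤ.* q) ℤ.- (ℤ.+ 6 ℤ.* r ℤ.+ ℤ.+ 8 ℤ.* p)
  rearrange = ℤ-Solver.solve-∀

z⁴[1-z]-vanishes : VanishesFrom 6 ((z ^ˢ 4) ⋆ (const (ℤ.+ 1) ⊖ z))
z⁴[1-z]-vanishes = ⋆-vanishes 4 1 z⁴-vanishes one-z-vanishes
  where
  one-z-vanishes : VanishesFrom 2 (const (ℤ.+ 1) ⊖ z)
  one-z-vanishes = vanishesFrom λ k → refl
  z⁴-vanishes : VanishesFrom 5 (z ^ˢ 4)
  z⁴-vanishes = ⋆-vanishes 1 3 z-vanishes (⋆-vanishes 1 2 z-vanishes (⋆-vanishes 1 1 z-vanishes
                  (⋆-vanishes 1 0 z-vanishes (const-vanishes _))))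

ogf-a′⋆cube : ∀ n → (ogf a′ ⋆ cube) n ≡ ((z ^ˢ 4) ⋆ (const (ℤ.+ 1) ⊖ z)) n
ogf-a′⋆cube 0 = refl
ogf-a′⋆cube 1 = refl
ogf-a′⋆cube 2 = refl
ogf-a′⋆cube 3 = refl
ogf-a′⋆cube 4 = refl
ogf-a′⋆cube 5 = refl
ogf-a′⋆cube 6 = refl
ogf-a′⋆cube (suc (suc (suc (suc (suc (suc (suc m))))))) = begin
  (ogf a′ ⋆ cube) (3 + (4 + m))
    ≡⟨ cong (ogf a′ ⋆ cube) (+-comm 3 (4 + m)) ⟩
  (ogf a′ ⋆ cube) ((4 + m) + 3)
    ≡⟨ ⋆-window cube 3 cube-vanishes (ogf a′) (4 + m) ⟩
  (ogf (λ k → a′ (k + (4 + m))) ⋆ cube) 3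
    ≡⟨ cube-annihilates (λ k → a′ (k + (4 + m))) (a′-recurrence m) ⟩
  ℤ.+ 0
    ≡⟨ vanishes z⁴[1-z]-vanishes (suc m) ⟨
  ((z ^ˢ 4) ⋆ (const (ℤ.+ 1) ⊖ z)) (7 + m) ∎
  where open ≡-Reasoning

-- Opened only here: the constructor `+_` makes sections such as `(x +_)` ambiguous.
open import Data.Integer using (+_)

mainTheorem3 : ∀ n →
    (ogf a ⋆ ((const (+ 1) ⊖ (const (+ 2) ⋆ z)) ^ˢ 3)) n
      ≡ ((z ^ˢ 4) ⋆ (const (+ 1) ⊖ z)) n
mainTheorem3 n = trans (⋆-congˡ cube (λ k → cong +_ (a≡a′ k)) n) (ogf-a′⋆cube n)
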